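{- Let $n\ge 2$ and let $i_1,\ldots,i_n$ be integers with $i_1,\ldots,i_n\ge 2^{2^{n-1}+1}$. Then ${\rm gp}(C_{i_1}\,\square\,\cdots\,\square\,C_{i_n}) \ge 2^{2^{n-1}}$.
   Context: $C_k$ denotes the cycle on $k$ vertices. The Cartesian product $X\,\square\,Y$ of graphs $X,Y$ has vertex set $V(X)\times V(Y)$, with $(x,y)$ adjacent to $(x',y')$ iff either $x=x'$ and $yy'\in E(Y)$, or $y=y'$ and $xx'\in E(X)$. For a connected graph $G$, a set $S\subseteq V(G)$ is a general position set if $d_G(u,v)\neq d_G(u,w)+d_G(w,v)$ for every three pairwise distinct $u,v,w\in S$, where $d_G$ is the shortest-path distance; ${\rm gp}(G)$ is the maximum cardinality of a general position set of $G$. -}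

module Defs where

open import Data.Nat using (ℕ; zero; suc; _+_)
open import Data.Fin using (Fin; toℕ)
open import Data.Unit using (⊤; tt)
open import Data.Empty using (⊥)
open import Data.Product using (_×_; _,_)
open import Data.Sum using (_⊎_)
open import Data.Vec using (Vec; []; _∷_)
open import Data.List using (List)
open import Data.List.Membership.Propositional using (_∈_)
open import Relation.Binary.PropositionalEquality using (_≡_; _≢_)
open import Relation.Nullary using (¬_)

record Graph : Set₁ where
  field
    V   : Set
    Adj : V → V → Set
open Graph public

CycStep : (k : ℕ) → Fin k → Fin k → Set
CycStep k x y = (suc (toℕ x) ≡ toℕ y) ⊎ ((suc (toℕ x) ≡ k) × (toℕ y ≡ 0))

Cycle : ℕ → Graph
Cycle k = record { V = Fin k ; Adj = λ x y → CycStep k x y ⊎ CycStep k y x }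

_□_ : Graph → Graph → Graph
X □ Y = record
  { V   = V X × V Y
  ; Adj = λ { (x , y) (x' , y') → ((x ≡ x') × Adj Y y y') ⊎ ((y ≡ y') × Adj X x x') } }

K1 : Graph
K1 = record { V = ⊤ ; Adj = λ _ _ → ⊥ }

-- C_{i_1} □ (C_{i_2} □ ( … □ C_{i_n})) (□ on the empty list is K_1, irrelevant for n ≥ 1
-- since C □ K_1 ≅ C).
CycleProduct : ∀ {n} → Vec ℕ n → Graph
CycleProduct []           = K1
CycleProduct (i ∷ [])     = Cycle i
CycleProduct (i ∷ j ∷ is) = Cycle i □ CycleProduct (j ∷ is)

data Walk (G : Graph) : V G → V G → ℕ → Set where
  here : ∀ {u} → Walk G u u 0
  step : ∀ {u w v k} → Adj G u w → Walk G w v k → Walk G u v (suc k)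

IsDist : (G : Graph) → V G → V G → ℕ → Set
IsDist G u v k = Walk G u v k × (∀ m → Walk G u v m → k Data.Nat.≤ m)

IsGPSet : (G : Graph) → List (V G) → Set
IsGPSet G S =
  ∀ {u v w} → u ∈ S → v ∈ S → w ∈ S → u ≢ v → u ≢ w → v ≢ w →
  ∀ {a b c} → IsDist G u v a → IsDist G u w b → IsDist G w v c → ¬ (a ≡ b + c)

-- Let M = 2 ^ 2 ^ (n - 1).  Since every cycle has length at least 2M, the grid [0, M)ⁿ with
-- the ℓ₁ metric embeds isometrically in C_{i₁} □ ⋯ □ C_{iₙ}: walks along the coordinates give
-- the upper bound, and on each factor the distance to vertex 0 is 1-Lipschitz and recovers the
-- coordinate, which gives the lower bound.  In ℓ₁, d(u,v) = d(u,w) + d(w,v) forces w between u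
-- and v in every coordinate, so it suffices to find M grid points no one of which lies
-- coordinatewise between two others.  These are indexed by the binary words of length 2ⁿ⁻¹:
-- if the halves u, v of a word of length 2ᵏ⁺¹ have coordinates uⱼ, vⱼ < N = 2 ^ 2 ^ k
-- (j ≤ k), the word has the k + 2 coordinates uⱼ N + vⱼ and u₀ N + (N - 1 - v₀).  The
-- reflected low digit handles the triples in which two words share their first half.

module Submission where

open import Data.Nat using (ℕ; zero; suc; _+_; _*_; _∸_; _^_; _⊓_; _≤_; _<_; z≤n; s≤s; ∣_-_∣)
open import Data.Nat.Properties
open import Algebra.Properties.CommutativeSemigroup +-commutativeSemigroup using (interchange)
open import Data.Bool using (Bool; true; false) renaming (_≟_ to _≟ᵇ_)
open import Data.Bool.Properties using (¬-not; not-injective)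
open import Data.Empty using (⊥-elim)
open import Data.Fin using (Fin; zero; suc; toℕ; fromℕ<; inject≤)
open import Data.Fin.Properties using (toℕ-injective; toℕ-fromℕ<; toℕ-inject≤; toℕ<n)
open import Data.Product using (Σ; _×_; _,_; proj₂)
open import Data.Product.Properties using (≡-dec)
open import Data.Sum using (_⊎_; inj₁; inj₂; swap)
open import Data.Vec using (Vec; []; _∷_; lookup; tabulate)
open import Data.Vec.Properties using (lookup∘tabulate)
open import Data.Vec.Relation.Unary.All using (All; []; _∷_)
import Data.Vec.Relation.Unary.All as All
open import Data.List using (List; []; _∷_; length; map; cartesianProduct)
open import Data.List.Properties using (length-map; length-++)
open import Data.List.Membership.Propositional.Properties using (∈-map⁻)
open import Data.List.Relation.Unary.Unique.Propositional using (Unique)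
open import Data.List.Relation.Unary.Unique.Propositional.Properties using (map⁺; cartesianProduct⁺)
import Data.List.Relation.Unary.All as ListAll
import Data.List.Relation.Unary.AllPairs as AllPairs
open import Function using (_∘_)
open import Relation.Nullary using (yes; no)
open import Relation.Binary.Definitions using (DecidableEquality; tri<; tri≈; tri>)
open import Relation.Binary.PropositionalEquality
open import Defs

private
  variable
    A B : Set
    G X Y : Graph
    a a' b b' c c' d h h' i k l m n o x y z : ℕ

∣m-n∣≤o : m ≤ o + n → n ≤ o + m → ∣ m - n ∣ ≤ o
∣m-n∣≤o {m} {o} {n} m≤o+n n≤o+m with ∣m-n∣≡[m∸n]∨[n∸m] m n
... | inj₁ e = subst (_≤ o) (sym e) (m≤n+o⇒m∸n≤o m n (subst (m ≤_) (+-comm o n) m≤o+n))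
... | inj₂ e = subst (_≤ o) (sym e) (m≤n+o⇒m∸n≤o n m (subst (n ≤_) (+-comm o m) n≤o+m))

Outside : ℕ → ℕ → ℕ → Set
Outside a b c = (c < a × c < b) ⊎ (a < c × b < c)

Outside-comm : Outside a b c → Outside b a c
Outside-comm (inj₁ (c<a , c<b)) = inj₁ (c<b , c<a)
Outside-comm (inj₂ (a<c , b<c)) = inj₂ (b<c , a<c)

Outside-cong : a ≡ a' → b ≡ b' → c ≡ c' → Outside a b c → Outside a' b' c'
Outside-cong refl refl refl o = o

Outside-diag : c ≢ a → Outside a a c
Outside-diag {c} {a} c≢a with <-cmp c a
... | tri< c<a _ _ = inj₁ (c<a , c<a)
... | tri≈ _ c≡a _ = ⊥-elim (c≢a c≡a)
... | tri> _ _ a<c = inj₂ (a<c , a<c)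

Outside-+ : ∀ s → Outside a b c → Outside (s + a) (s + b) (s + c)
Outside-+ s (inj₁ (c<a , c<b)) = inj₁ (+-monoʳ-< s c<a , +-monoʳ-< s c<b)
Outside-+ s (inj₂ (a<c , b<c)) = inj₂ (+-monoʳ-< s a<c , +-monoʳ-< s b<c)

strict-triangle-≥ : b ≤ a → Outside a b c → ∣ a - b ∣ < ∣ a - c ∣ + ∣ c - b ∣
strict-triangle-≥ {b} {a} {c} b≤a (inj₁ (c<a , c<b)) = begin-strict
  ∣ a - b ∣             ≡⟨ m≤n⇒∣n-m∣≡n∸m b≤a ⟩
  a ∸ b                 <⟨ ∸-monoʳ-< c<b b≤a ⟩
  a ∸ c                 ≡⟨ m≤n⇒∣n-m∣≡n∸m (<⇒≤ c<a) ⟨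
  ∣ a - c ∣             ≤⟨ m≤m+n _ _ ⟩
  ∣ a - c ∣ + ∣ c - b ∣ ∎
  where open ≤-Reasoning
strict-triangle-≥ {b} {a} {c} b≤a (inj₂ (a<c , b<c)) = begin-strict
  ∣ a - b ∣             ≡⟨ m≤n⇒∣n-m∣≡n∸m b≤a ⟩
  a ∸ b                 <⟨ ∸-monoˡ-< a<c b≤a ⟩
  c ∸ b                 ≡⟨ m≤n⇒∣n-m∣≡n∸m (<⇒≤ b<c) ⟨
  ∣ c - b ∣             ≤⟨ m≤n+m _ _ ⟩
  ∣ a - c ∣ + ∣ c - b ∣ ∎
  where open ≤-Reasoning

∣-∣-strict-triangle : Outside a b c → ∣ a - b ∣ < ∣ a - c ∣ + ∣ c - b ∣
∣-∣-strict-triangle {a} {b} {c} o with ≤-total b a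
... | inj₁ b≤a = strict-triangle-≥ b≤a o
... | inj₂ a≤b =
  subst₂ _<_ (∣-∣-comm b a) (trans (+-comm ∣ b - c ∣ ∣ c - a ∣) (cong₂ _+_ (∣-∣-comm c a) (∣-∣-comm b c)))
             (strict-triangle-≥ a≤b (Outside-comm o))

lex-< : x < m → a < a' → a * m + x < a' * m + y
lex-< {x} {m} {a} {a'} {y} x<m a<a' = begin-strict
  a * m + x  <⟨ +-monoʳ-< (a * m) x<m ⟩
  a * m + m  ≡⟨ +-comm (a * m) m ⟩
  suc a * m  ≤⟨ *-monoˡ-≤ m a<a' ⟩
  a' * m     ≤⟨ m≤m+n (a' * m) y ⟩
  a' * m + y ∎
  where open ≤-Reasoning

lex-bound : a < m → x < m → a * m + x < m * m
lex-bound {a} {m} {x} a<m x<m = subst (a * m + x <_) (+-identityʳ (m * m)) (lex-< x<m a<m)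

lex-injective : x < m → y < m → a * m + x ≡ a' * m + y → a ≡ a' × x ≡ y
lex-injective {x} {m} {y} {a} {a'} x<m y<m e with <-cmp a a'
... | tri< a<a' _ _ = ⊥-elim (<-irrefl e (lex-< x<m a<a'))
... | tri> _ _ a'<a = ⊥-elim (<-irrefl (sym e) (lex-< y<m a'<a))
... | tri≈ _ refl _ = refl , +-cancelˡ-≡ (a * m) x y e

Outside-lex : x < m → y < m → z < m → Outside a b c → Outside (a * m + x) (b * m + y) (c * m + z)
Outside-lex x<m y<m z<m (inj₁ (c<a , c<b)) = inj₁ (lex-< z<m c<a , lex-< z<m c<b)
Outside-lex x<m y<m z<m (inj₂ (a<c , b<c)) = inj₂ (lex-< x<m a<c , lex-< y<m b<c)

Outside-lex-below : z < m → h < h' → z < x → Outside (h * m + x) (h' * m + y) (h * m + z)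
Outside-lex-below {m = m} {h} z<m h<h' z<x = inj₁ (+-monoʳ-< (h * m) z<x , lex-< z<m h<h')

Outside-lex-above : y < m → h' < h → x < z → Outside (h * m + x) (h' * m + y) (h * m + z)
Outside-lex-above {m = m} {h = h} y<m h'<h x<z = inj₂ (+-monoʳ-< (h * m) x<z , lex-< y<m h'<h)

reflect : ℕ → ℕ → ℕ
reflect m x = m ∸ suc x

reflect-< : x < m → reflect m x < m
reflect-< {x} {m} x<m = ∸-monoʳ-< {m} {suc x} {0} (s≤s z≤n) x<m

reflect-anti : x < y → y < m → reflect m y < reflect m x
reflect-anti x<y y<m = ∸-monoʳ-< (s≤s x<y) y<m

reflect-injective : x < m → y < m → reflect m x ≡ reflect m y → x ≡ y
reflect-injective x<m y<m e = suc-injective (∸-cancelˡ-≡ x<m y<m e)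

Word : ℕ → Set
Word zero    = Bool
Word (suc k) = Word k × Word k

_≟ʷ_ : DecidableEquality (Word k)
_≟ʷ_ {zero}  = _≟ᵇ_
_≟ʷ_ {suc k} = ≡-dec _≟ʷ_ _≟ʷ_

width : ℕ → ℕ
width zero    = 2
width (suc k) = width k * width k

coord : (k : ℕ) → Fin (suc k) → Word k → ℕ
coord zero    _       false   = 0
coord zero    _       true    = 1
coord (suc k) zero    (u , v) = coord k zero u * width k + reflect (width k) (coord k zero v)
coord (suc k) (suc j) (u , v) = coord k j u * width k + coord k j v

coord<width : ∀ k j (w : Word k) → coord k j w < width k
coord<width zero    _       false   = s≤s z≤n
coord<width zero    _       true    = s≤s (s≤s z≤n)
coord<width (suc k) zero    (u , v) = lex-bound (coord<width k zero u) (reflect-< (coord<width k zero v))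
coord<width (suc k) (suc j) (u , v) = lex-bound (coord<width k j u) (coord<width k j v)

coord-injective : ∀ k j {u w : Word k} → coord k j u ≡ coord k j w → u ≡ w
coord-injective zero    _ {false} {false} _ = refl
coord-injective zero    _ {true}  {true}  _ = refl
coord-injective (suc k) zero {u , v} {u' , v'} e
  with lex-injective (reflect-< (coord<width k zero v)) (reflect-< (coord<width k zero v')) e
... | eu , ev = cong₂ _,_ (coord-injective k zero eu)
                  (coord-injective k zero (reflect-injective (coord<width k zero v) (coord<width k zero v') ev))
coord-injective (suc k) (suc j) {u , v} {u' , v'} e
  with lex-injective (coord<width k j v) (coord<width k j v') e
... | eu , ev = cong₂ _,_ (coord-injective k j eu) (coord-injective k j ev)

Separated : (k : ℕ) → Word k → Word k → Word k → Set
Separated k u v w = Σ (Fin (suc k)) λ j → Outside (coord k j u) (coord k j v) (coord k j w)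

-- The low halves of u and w are compared in one order by coordinate 1 and, through the
-- reflection, in the opposite order by coordinate 0; one of the two puts w beyond u,
-- on the side away from v.
separated-sharingHigh : ∀ k {a a' b b' c : Word k} → a ≢ a' → b ≢ c →
                        Separated (suc k) (a , b) (a' , b') (a , c)
separated-sharingHigh k {a} {a'} {b} {b'} {c} a≢a' b≢c
  with <-cmp (coord k zero a) (coord k zero a') | <-cmp (coord k zero c) (coord k zero b)
... | tri≈ _ e _ | _ = ⊥-elim (a≢a' (coord-injective k zero e))
... | _ | tri≈ _ e _ = ⊥-elim (b≢c (sym (coord-injective k zero e)))
... | tri< h<h' _ _ | tri< c<b _ _ =
  suc zero , Outside-lex-below (coord<width k zero c) h<h' c<b
... | tri< h<h' _ _ | tri> _ _ b<c =
  zero , Outside-lex-below (reflect-< (coord<width k zero c)) h<h' (reflect-anti b<c (coord<width k zero c))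
... | tri> _ _ h'<h | tri> _ _ b<c =
  suc zero , Outside-lex-above (coord<width k zero b') h'<h b<c
... | tri> _ _ h'<h | tri< c<b _ _ =
  zero , Outside-lex-above (reflect-< (coord<width k zero b')) h'<h (reflect-anti c<b (coord<width k zero b))

separated : ∀ k {u v w : Word k} → u ≢ v → u ≢ w → v ≢ w → Separated k u v w
separated zero u≢v u≢w v≢w = ⊥-elim (v≢w (not-injective (trans (sym (¬-not u≢v)) (¬-not u≢w))))
separated (suc k) {a , b} {a' , b'} {a'' , c} u≢v u≢w v≢w with a ≟ʷ a' | a ≟ʷ a'' | a' ≟ʷ a''
... | yes refl | yes refl | _ with separated k (u≢v ∘ cong (a ,_)) (u≢w ∘ cong (a ,_)) (v≢w ∘ cong (a ,_))
...   | j , o = suc j , Outside-+ (coord k j a * width k) o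
separated (suc k) {a , b} {_ , b'} {a'' , c} u≢v u≢w v≢w | yes refl | no a≢a'' | _ =
  suc zero , Outside-lex (coord<width k zero b) (coord<width k zero b') (coord<width k zero c)
                         (Outside-diag (a≢a'' ∘ sym ∘ coord-injective k zero))
separated (suc k) {a , b} {a' , b'} {_ , c} u≢v u≢w v≢w | no a≢a' | yes refl | _ =
  separated-sharingHigh k a≢a' (u≢w ∘ cong (a ,_))
separated (suc k) {a , b} {a' , b'} {_ , c} u≢v u≢w v≢w | no a≢a' | no _ | yes refl
  with separated-sharingHigh k (a≢a' ∘ sym) (v≢w ∘ cong (a' ,_))
...   | j , o = j , Outside-comm o
separated (suc k) {a , b} {a' , b'} {a'' , c} u≢v u≢w v≢w | no a≢a' | no a≢a'' | no a'≢a''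
  with separated k a≢a' a≢a'' a'≢a''
...   | j , o = suc j , Outside-lex (coord<width k j b) (coord<width k j b') (coord<width k j c) o

words : (k : ℕ) → List (Word k)
words zero    = false ∷ true ∷ []
words (suc k) = cartesianProduct (words k) (words k)

words-unique : ∀ k → Unique (words k)
words-unique zero    = ((λ ()) ListAll.∷ ListAll.[]) AllPairs.∷ ListAll.[] AllPairs.∷ AllPairs.[]
words-unique (suc k) = cartesianProduct⁺ (words-unique k) (words-unique k)

length-cartesianProduct : (xs : List A) (ys : List B) →
  length (cartesianProduct xs ys) ≡ length xs * length ys
length-cartesianProduct []       ys = refl
length-cartesianProduct (x ∷ xs) ys = trans (length-++ (map (x ,_) ys))
  (cong₂ _+_ (length-map (x ,_) ys) (length-cartesianProduct xs ys))

length-words : ∀ k → length (words k) ≡ width k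
length-words zero    = refl
length-words (suc k) = trans (length-cartesianProduct (words k) (words k))
                         (cong₂ _*_ (length-words k) (length-words k))

width≡2^2^k : ∀ k → width k ≡ 2 ^ 2 ^ k
width≡2^2^k zero    = refl
width≡2^2^k (suc k) = begin
  width k * width k       ≡⟨ cong₂ _*_ (width≡2^2^k k) (width≡2^2^k k) ⟩
  2 ^ 2 ^ k * 2 ^ 2 ^ k   ≡⟨ ^-distribˡ-+-* 2 (2 ^ k) (2 ^ k) ⟨
  2 ^ (2 ^ k + 2 ^ k)     ≡⟨ cong (λ e → 2 ^ (2 ^ k + e)) (+-identityʳ (2 ^ k)) ⟨
  2 ^ 2 ^ suc k           ∎
  where open ≡-Reasoning

2^[2^k+1]≡width+width : ∀ k → 2 ^ (2 ^ k + 1) ≡ width k + width k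
2^[2^k+1]≡width+width k = begin
  2 ^ (2 ^ k + 1)             ≡⟨ ^-distribˡ-+-* 2 (2 ^ k) 1 ⟩
  2 ^ 2 ^ k * 2               ≡⟨ *-comm (2 ^ 2 ^ k) 2 ⟩
  2 ^ 2 ^ k + (2 ^ 2 ^ k + 0) ≡⟨ cong (2 ^ 2 ^ k +_) (+-identityʳ (2 ^ 2 ^ k)) ⟩
  2 ^ 2 ^ k + 2 ^ 2 ^ k       ≡⟨ cong₂ _+_ (width≡2^2^k k) (width≡2^2^k k) ⟨
  width k + width k           ∎
  where open ≡-Reasoning

_++ᵂ_ : ∀ {u v w} → Walk G u v k → Walk G v w l → Walk G u w (k + l)
here       ++ᵂ W = W
step e V ++ᵂ W = step e (V ++ᵂ W)

Walk-reverse : (∀ {u v} → Adj G u v → Adj G v u) → ∀ {u v} → Walk G u v k → Walk G v u k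
Walk-reverse adj-sym here                = here
Walk-reverse adj-sym (step {k = k} e W) =
  subst (Walk _ _ _) (+-comm k 1) (Walk-reverse adj-sym W ++ᵂ step (adj-sym e) here)

□-walkˡ : ∀ {x x'} y → Walk X x x' k → Walk (X □ Y) (x , y) (x' , y) k
□-walkˡ y here       = here
□-walkˡ y (step e W) = step (inj₂ (refl , e)) (□-walkˡ y W)

□-walkʳ : ∀ x {y y'} → Walk Y y y' k → Walk (X □ Y) (x , y) (x , y') k
□-walkʳ x here       = here
□-walkʳ x (step e W) = step (inj₁ (refl , e)) (□-walkʳ x W)

□-walk-split : ∀ {x x' y y'} → Walk (X □ Y) (x , y) (x' , y') n →
  Σ ℕ λ k → Σ ℕ λ l → Walk X x x' k × Walk Y y y' l × k + l ≡ n
□-walk-split here = 0 , 0 , here , here , refl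
□-walk-split (step (inj₁ (refl , e)) W) with □-walk-split W
... | k , l , U , V , k+l≡n = k , suc l , U , step e V , trans (+-suc k l) (cong suc k+l≡n)
□-walk-split (step (inj₂ (refl , e)) W) with □-walk-split W
... | k , l , U , V , k+l≡n = suc k , l , step e U , V , cong suc k+l≡n

IsDist-unique : ∀ {u v} → IsDist G u v k → IsDist G u v l → k ≡ l
IsDist-unique (U , U-min) (V , V-min) = ≤-antisym (U-min _ V) (V-min _ U)

IsDist-□ : ∀ {x x' y y'} → IsDist X x x' k → IsDist Y y y' l → IsDist (X □ Y) (x , y) (x' , y') (k + l)
IsDist-□ {k = k} {l = l} {x' = x'} {y = y} (U , U-min) (V , V-min) = □-walkˡ y U ++ᵂ □-walkʳ x' V , minimal
  where
  minimal : ∀ n → Walk _ _ _ n → k + l ≤ n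
  minimal n W with □-walk-split W
  ... | k' , l' , U' , V' , k'+l'≡n = subst (k + l ≤_) k'+l'≡n (+-mono-≤ (U-min k' U') (V-min l' V'))

Lipschitz : (G : Graph) → (V G → ℕ) → Set
Lipschitz G f = ∀ {u v} → Adj G u v → ∣ f u - f v ∣ ≤ 1

Lipschitz-walk : ∀ {f} → Lipschitz G f → ∀ {u v} → Walk G u v k → ∣ f u - f v ∣ ≤ k
Lipschitz-walk {f = f} L {u} here = ≤-reflexive (∣n-n∣≡0 (f u))
Lipschitz-walk {f = f} L (step {u} {w} {v} e W) =
  ≤-trans (∣-∣-triangle (f u) (f w) (f v)) (+-mono-≤ (L e) (Lipschitz-walk {f = f} L W))

ℓ₁ : Vec (Fin m) d → Vec (Fin m) d → ℕ
ℓ₁ []      []      = 0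
ℓ₁ (a ∷ x) (b ∷ y) = ∣ toℕ a - toℕ b ∣ + ℓ₁ x y

ℓ₁-triangle : (x y z : Vec (Fin m) d) → ℓ₁ x y ≤ ℓ₁ x z + ℓ₁ z y
ℓ₁-triangle []      []      []      = z≤n
ℓ₁-triangle (a ∷ x) (b ∷ y) (c ∷ z) =
  ≤-trans (+-mono-≤ (∣-∣-triangle (toℕ a) (toℕ c) (toℕ b)) (ℓ₁-triangle x y z))
          (≤-reflexive (interchange ∣ toℕ a - toℕ c ∣ ∣ toℕ c - toℕ b ∣ (ℓ₁ x z) (ℓ₁ z y)))

ℓ₁≡0⇒≡ : (x y : Vec (Fin m) d) → ℓ₁ x y ≡ 0 → x ≡ y
ℓ₁≡0⇒≡ []      []      _ = refl
ℓ₁≡0⇒≡ (a ∷ x) (b ∷ y) e =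
  cong₂ _∷_ (toℕ-injective (∣m-n∣≡0⇒m≡n (m+n≡0⇒m≡0 _ e)))
            (ℓ₁≡0⇒≡ x y (m+n≡0⇒n≡0 _ e))

Separates : (x y z : Vec (Fin m) d) → Set
Separates {d = d} x y z =
  Σ (Fin d) λ j → Outside (toℕ (lookup x j)) (toℕ (lookup y j)) (toℕ (lookup z j))

ℓ₁-strict-triangle : (x y z : Vec (Fin m) d) → Separates x y z → ℓ₁ x y < ℓ₁ x z + ℓ₁ z y
ℓ₁-strict-triangle (a ∷ x) (b ∷ y) (c ∷ z) (j , o) =
  <-≤-trans (coordinatewise (j , o))
            (≤-reflexive (interchange ∣ toℕ a - toℕ c ∣ ∣ toℕ c - toℕ b ∣ (ℓ₁ x z) (ℓ₁ z y)))
  where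
  coordinatewise : Separates (a ∷ x) (b ∷ y) (c ∷ z) →
    ∣ toℕ a - toℕ b ∣ + ℓ₁ x y < (∣ toℕ a - toℕ c ∣ + ∣ toℕ c - toℕ b ∣) + (ℓ₁ x z + ℓ₁ z y)
  coordinatewise (zero  , o) = +-mono-<-≤ (∣-∣-strict-triangle o) (ℓ₁-triangle x y z)
  coordinatewise (suc j , o) =
    +-mono-≤-< (∣-∣-triangle (toℕ a) (toℕ c) (toℕ b)) (ℓ₁-strict-triangle x y z (j , o))

record GridEmbedding (G : Graph) (d m : ℕ) : Set where
  field
    embed    : Vec (Fin m) d → V G
    distance : ∀ x y → IsDist G (embed x) (embed y) (ℓ₁ x y)

  embed-injective : ∀ {x y} → embed x ≡ embed y → x ≡ y
  embed-injective {x} {y} e =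
    ℓ₁≡0⇒≡ x y (n≤0⇒n≡0 (proj₂ (distance x y) 0 (subst (λ v → Walk G (embed x) v 0) e here)))

  embed-IsGPSet : (f : A → Vec (Fin m) d) (P : List A) →
    (∀ {p q r} → p ≢ q → p ≢ r → q ≢ r → Separates (f p) (f q) (f r)) →
    IsGPSet G (map (embed ∘ f) P)
  embed-IsGPSet f P sep u∈P v∈P w∈P u≢v u≢w v≢w Duv Duw Dwv a≡b+c
    with ∈-map⁻ (embed ∘ f) u∈P | ∈-map⁻ (embed ∘ f) v∈P | ∈-map⁻ (embed ∘ f) w∈P
  ... | p , _ , refl | q , _ , refl | r , _ , refl =
    <-irrefl a≡b+c
      (subst₂ _<_ (IsDist-unique (distance (f p) (f q)) Duv)
                  (cong₂ _+_ (IsDist-unique (distance (f p) (f r)) Duw) (IsDist-unique (distance (f r) (f q)) Dwv))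
                  (ℓ₁-strict-triangle (f p) (f q) (f r)
                     (sep (u≢v ∘ cong (embed ∘ f)) (u≢w ∘ cong (embed ∘ f))
                          (v≢w ∘ cong (embed ∘ f)))))

□-grid : GridEmbedding X 1 m → GridEmbedding Y d m → GridEmbedding (X □ Y) (suc d) m
□-grid {X} {m} {Y} {d} E F = record { embed = embed ; distance = distance }
  where
  module E = GridEmbedding E
  module F = GridEmbedding F

  embed : Vec (Fin m) (suc d) → V (X □ Y)
  embed (a ∷ x) = E.embed (a ∷ []) , F.embed x

  distance : ∀ x y → IsDist (X □ Y) (embed x) (embed y) (ℓ₁ x y)
  distance (a ∷ x) (b ∷ y) = subst (IsDist _ _ _) (cong (_+ ℓ₁ x y) (+-identityʳ ∣ toℕ a - toℕ b ∣))
    (IsDist-□ (E.distance (a ∷ []) (b ∷ [])) (F.distance x y))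

dist₀ : ℕ → ℕ → ℕ
dist₀ i x = x ⊓ (i ∸ x)

m∸n≤1+m∸[1+n] : ∀ m n → m ∸ n ≤ suc (m ∸ suc n)
m∸n≤1+m∸[1+n] zero    zero    = z≤n
m∸n≤1+m∸[1+n] zero    (suc n) = z≤n
m∸n≤1+m∸[1+n] (suc m) zero    = ≤-refl
m∸n≤1+m∸[1+n] (suc m) (suc n) = m∸n≤1+m∸[1+n] m n

∣dist₀-dist₀-suc∣≤1 : ∀ i x → ∣ dist₀ i x - dist₀ i (suc x) ∣ ≤ 1
∣dist₀-dist₀-suc∣≤1 i x = ∣m-n∣≤o
  (⊓-mono-≤ (≤-trans (n≤1+n x) (n≤1+n (suc x))) (m∸n≤1+m∸[1+n] i x))
  (⊓-mono-≤ (≤-refl {suc x}) (≤-trans (∸-monoʳ-≤ i (n≤1+n x)) (n≤1+n (i ∸ x))))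

dist₀-small : x + x ≤ i → dist₀ i x ≡ x
dist₀-small {x} x+x≤i = m≤n⇒m⊓n≡m (m+n≤o⇒m≤o∸n x x+x≤i)

CycStep-Lipschitz : ∀ {x y} → CycStep i x y → ∣ dist₀ i (toℕ x) - dist₀ i (toℕ y) ∣ ≤ 1
CycStep-Lipschitz {i} {x} (inj₁ e) rewrite sym e = ∣dist₀-dist₀-suc∣≤1 i (toℕ x)
CycStep-Lipschitz {i} {x} (inj₂ (last , e)) rewrite e = begin
  ∣ dist₀ i (toℕ x) - 0 ∣   ≡⟨ ∣-∣-identityʳ (dist₀ i (toℕ x)) ⟩
  dist₀ i (toℕ x)           ≤⟨ m⊓n≤n (toℕ x) (i ∸ toℕ x) ⟩
  i ∸ toℕ x              ≡⟨ cong (_∸ toℕ x) last ⟨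
  suc (toℕ x) ∸ toℕ x    ≡⟨ m+n∸n≡m 1 (toℕ x) ⟩
  1                      ∎
  where open ≤-Reasoning

dist₀-Lipschitz : Lipschitz (Cycle i) (dist₀ i ∘ toℕ)
dist₀-Lipschitz (inj₁ s) = CycStep-Lipschitz s
dist₀-Lipschitz {i} {x} {y} (inj₂ s) =
  subst (_≤ 1) (∣-∣-comm (dist₀ i (toℕ y)) (dist₀ i (toℕ x))) (CycStep-Lipschitz s)

ascend : ∀ d (x y : Fin i) → toℕ x + d ≡ toℕ y → Walk (Cycle i) x y d
ascend zero x y e =
  subst (λ z → Walk _ x z 0) (toℕ-injective (trans (sym (+-identityʳ (toℕ x))) e)) here
ascend {i} (suc d) x y e =
  step (inj₁ (inj₁ (sym (toℕ-fromℕ< x+1<i)))) (ascend d (fromℕ< x+1<i) y next+d≡y)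
  where
  x+1+d≡y : suc (toℕ x + d) ≡ toℕ y
  x+1+d≡y = trans (sym (+-suc (toℕ x) d)) e
  x+1<i : suc (toℕ x) < i
  x+1<i = ≤-<-trans (m≤m+n (suc (toℕ x)) d) (subst (_< i) (sym x+1+d≡y) (toℕ<n y))
  next+d≡y : toℕ (fromℕ< x+1<i) + d ≡ toℕ y
  next+d≡y = trans (cong (_+ d) (toℕ-fromℕ< x+1<i)) x+1+d≡y

cycle-walk : (x y : Fin i) → Walk (Cycle i) x y ∣ toℕ x - toℕ y ∣
cycle-walk x y with ≤-total (toℕ x) (toℕ y)
... | inj₁ x≤y = subst (Walk _ x y) (sym (m≤n⇒∣m-n∣≡n∸m x≤y)) (ascend _ x y (m+[n∸m]≡n x≤y))
... | inj₂ y≤x = subst (Walk _ x y) (sym (m≤n⇒∣n-m∣≡n∸m y≤x))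
                   (Walk-reverse swap (ascend _ y x (m+[n∸m]≡n y≤x)))

cycle-grid : m + m ≤ i → GridEmbedding (Cycle i) 1 m
cycle-grid {m} {i} m+m≤i = record { embed = embed ; distance = distance }
  where
  m≤i : m ≤ i
  m≤i = m+n≤o⇒m≤o m m+m≤i

  embed : Vec (Fin m) 1 → Fin i
  embed (a ∷ []) = inject≤ a m≤i

  toℕ-embed : ∀ a → toℕ (embed (a ∷ [])) ≡ toℕ a
  toℕ-embed a = toℕ-inject≤ a m≤i

  dist₀-embed : ∀ a → dist₀ i (toℕ (embed (a ∷ []))) ≡ toℕ a
  dist₀-embed a rewrite toℕ-embed a = dist₀-small (≤-trans (+-mono-≤ a≤m a≤m) m+m≤i)
    where a≤m = <⇒≤ (toℕ<n a)

  distance : ∀ x y → IsDist (Cycle i) (embed x) (embed y) (ℓ₁ x y)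
  distance (a ∷ []) (b ∷ []) rewrite +-identityʳ ∣ toℕ a - toℕ b ∣ =
    subst (Walk _ _ _) (cong₂ ∣_-_∣ (toℕ-embed a) (toℕ-embed b)) (cycle-walk _ _) ,
    λ k W → subst₂ (λ s t → ∣ s - t ∣ ≤ k) (dist₀-embed a) (dist₀-embed b)
                   (Lipschitz-walk {f = dist₀ i ∘ toℕ} dist₀-Lipschitz W)

cycleProduct-grid : (is : Vec ℕ (suc d)) → All (λ i → m + m ≤ i) is →
                    GridEmbedding (CycleProduct is) (suc d) m
cycleProduct-grid (i ∷ [])     (m+m≤i ∷ [])  = cycle-grid m+m≤i
cycleProduct-grid (i ∷ j ∷ is) (m+m≤i ∷ ps) = □-grid (cycle-grid m+m≤i) (cycleProduct-grid (j ∷ is) ps)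

toGrid : (k : ℕ) → Word k → Vec (Fin (width k)) (suc k)
toGrid k w = tabulate λ j → fromℕ< (coord<width k j w)

toℕ-lookup-toGrid : ∀ k w j → toℕ (lookup (toGrid k w) j) ≡ coord k j w
toℕ-lookup-toGrid k w j =
  trans (cong toℕ (lookup∘tabulate (λ j → fromℕ< (coord<width k j w)) j)) (toℕ-fromℕ< (coord<width k j w))

toGrid-injective : ∀ k {u w} → toGrid k u ≡ toGrid k w → u ≡ w
toGrid-injective k {u} {w} e = coord-injective k zero
  (trans (sym (toℕ-lookup-toGrid k u zero))
         (trans (cong (λ x → toℕ (lookup x zero)) e) (toℕ-lookup-toGrid k w zero)))

toGrid-separates : ∀ k {u v w} → u ≢ v → u ≢ w → v ≢ w →
                   Separates (toGrid k u) (toGrid k v) (toGrid k w)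
toGrid-separates k {u} {v} {w} u≢v u≢w v≢w with separated k u≢v u≢w v≢w
... | j , o = j , Outside-cong (sym (toℕ-lookup-toGrid k u j)) (sym (toℕ-lookup-toGrid k v j))
                               (sym (toℕ-lookup-toGrid k w j)) o

corollary3p2 : (n : ℕ) → 2 ≤ n → (is : Vec ℕ n) →
    All (λ i → 2 ^ (2 ^ (n ∸ 1) + 1) ≤ i) is →
    Σ (List (V (CycleProduct is))) (λ S →
      Unique S × IsGPSet (CycleProduct is) S × 2 ^ (2 ^ (n ∸ 1)) ≤ length S)
corollary3p2 zero    ()  _  _
corollary3p2 (suc k) _   is large =
  map (embed ∘ toGrid k) (words k) ,
  map⁺ (toGrid-injective k ∘ embed-injective) (words-unique k) ,
  embed-IsGPSet (toGrid k) (words k) (toGrid-separates k) ,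
  ≤-reflexive (sym (trans (length-map (embed ∘ toGrid k) (words k))
                          (trans (length-words k) (width≡2^2^k k))))
  where
  grid : GridEmbedding (CycleProduct is) (suc k) (width k)
  grid = cycleProduct-grid is (All.map (λ {i} → subst (_≤ i) (2^[2^k+1]≡width+width k)) large)
  open GridEmbedding grid
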